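{- For every integer $a\ge1$ and every $n\le 4$, with $\mathbf{s}=(a,\dots,a,a+1)$ of length $n$ (i.e. $s_1=\dots=s_{n-1}=a$, $s_n=a+1$), the simplex $\mathcal{P}_n^{\mathbf{s}}$ is Ehrhart positive.
   Context: For a sequence of positive integers $\mathbf{s}=(s_1,\dots,s_n)$, $\mathcal{P}_n^{\mathbf{s}}=\{\mathbf{x}\in\mathbb{R}^n : 0\le x_1/s_1\le\dots\le x_n/s_n\le1\}$. A lattice polytope $P\subset\mathbb{R}^n$ is Ehrhart positive if all coefficients (in the monomial basis) of its Ehrhart polynomial $\mathcal{L}_P(t)$, defined by $\mathcal{L}_P(t)=|tP\cap\mathbb{Z}^n|$ for positive integers $t$, are nonnegative. -}

module Defs where

open import Data.Nat using (ℕ; zero; suc; _*_; _≤ᵇ_; _≤_)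
open import Data.Bool using (Bool; true; _∧_)
open import Data.List using (List; []; _∷_; [_]; map; concatMap; upTo; length; filterᵇ)
open import Data.List.Relation.Unary.All using (All)
open import Data.Vec using (Vec; []; _∷_; _∷ʳ_; replicate)
import Data.Vec as Vec
open import Data.Integer using (+_)
open import Data.Rational using (ℚ; 0ℚ; _/_) renaming (_+_ to _+ℚ_; _*_ to _*ℚ_; _≤_ to _≤ℚ_)
open import Data.Product using (Σ; _×_)
open import Relation.Binary.PropositionalEquality using (_≡_)

-- membership test for x ∈ t·P_n^s (x a natural-number vector):
--   x_1/s_1 ≤ x_2/s_2 ≤ … ≤ x_n/s_n ≤ t, cleared of (positive) denominators.
inDilate : ∀ {n} → Vec ℕ n → Vec ℕ n → ℕ → Bool
inDilate [] [] t = true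
inDilate (s ∷ []) (x ∷ []) t = x ≤ᵇ t * s
inDilate (s ∷ s' ∷ ss) (x ∷ x' ∷ xs) t =
  (x * s' ≤ᵇ x' * s) ∧ inDilate (s' ∷ ss) (x' ∷ xs) t

box : ∀ {n} → Vec ℕ n → List (Vec ℕ n)
box [] = [ [] ]
box (b ∷ bs) = concatMap (λ x → map (x ∷_) (box bs)) (upTo (suc b))

ehrhart : ∀ {n} → Vec ℕ n → ℕ → ℕ
ehrhart s t = length (filterᵇ (λ x → inDilate s x t) (box (Vec.map (t *_) s)))

evalPoly : List ℚ → ℚ → ℚ
evalPoly [] x = 0ℚ
evalPoly (c ∷ cs) x = c +ℚ x *ℚ evalPoly cs x

ℕtoℚ : ℕ → ℚ
ℕtoℚ k = + k / 1

EhrhartPositive : ∀ {n} → Vec ℕ n → Set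
EhrhartPositive s =
  Σ (List ℚ) λ cs → All (0ℚ ≤ℚ_) cs ×
    ((t : ℕ) → 1 ≤ t → evalPoly cs (ℕtoℚ t) ≡ ℕtoℚ (ehrhart s t))

sSeq : (a m : ℕ) → Vec ℕ (suc m)
sSeq a m = replicate m a ∷ʳ suc a

-- Let s = (a, …, a, a+1) have length m + 2 and write z for the last coordinate. As the first
-- m + 1 denominators agree, a point of tP is a chain x₁ ≤ ⋯ ≤ x_{m+1} ≤ ⌊za/(a+1)⌋ with
-- z ≤ t(a+1). Summing out x₁, x₂, … in turn with the hockey-stick identity, the chains below y
-- number C(y+m+1, m+1); as z runs through a block q(a+1), …, q(a+1)+a the floor takes the value
-- qa twice and qa+1, …, qa+a−1 once. Hence
--   L(t) = Σ_{q<t} C(qa+m+1, m+1) + C(ta+m+2, m+2),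
-- and for m ≤ 2 Pascal's rule and induction on t show that 24·L(t) is a polynomial in t whose
-- coefficients are polynomials in a with nonnegative coefficients. For n = 1, L(t) = t(a+1) + 1.

module Submission where

open import Defs
open import Data.Bool using (Bool; true; false; _∧_)
open import Data.Bool.Properties using (∧-identityʳ)
import Data.Integer as ℤ
import Data.Integer.Properties as ℤ
open import Data.List using (List; []; _∷_; [_]; _++_; _∷ʳ_; length; filterᵇ; map; concatMap; upTo)
open import Data.List.Properties
  using (filter-++; length-++; applyUpTo-∷ʳ; concatMap-++; ++-identityʳ; map-cong; map-∘)
open import Data.List.Relation.Unary.All using (All; []; _∷_)
open import Data.Nat
open import Data.Nat.Combinatorics using (_C_; nCn≡1; nCk+nC[k+1]≡[n+1]C[k+1])
open import Data.Nat.Coprimality as Coprime using (1-coprimeTo)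
open import Data.Nat.Divisibility using (n∣m*n)
open import Data.Nat.DivMod using (m*n/n≡m; m/n*n≤m; /-monoˡ-≤; +-distrib-/-∣ˡ; m<n⇒m/n≡0)
open import Data.Nat.Properties
open import Algebra.Properties.CommutativeSemigroup +-commutativeSemigroup
  using () renaming (interchange to +-interchange)
open import Data.Nat.Tactic.RingSolver using (solve-∀)
open import Data.Product using (_,_)
open import Data.Rational as ℚ using (ℚ; mkℚ; 0ℚ; 1ℚ)
open import Data.Rational.Properties using (normalize-coprime; normalize-nonNeg; nonNegative⁻¹)
  renaming ( *-assoc to ℚ-*-assoc; *-comm to ℚ-*-comm; *-identityʳ to ℚ-*-identityʳ
           ; *-zeroˡ to ℚ-*-zeroˡ; *-distribʳ-+ to ℚ-*-distribʳ-+)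
open import Data.Vec using (Vec; []; _∷_)
import Data.Vec as Vec
open import Function using (id; _∘_)
open import Relation.Binary.PropositionalEquality
  using (_≡_; refl; sym; trans; cong; cong₂; subst; module ≡-Reasoning)
open import Relation.Nullary.Decidable using (T?)
open import Relation.Nullary.Negation using (contradiction)
open import Relation.Nullary.Reflects using (ofʸ; ofⁿ)

𝟙 : Bool → ℕ
𝟙 true  = 1
𝟙 false = 0

≤ᵇ-true : ∀ {m n} → m ≤ n → (m ≤ᵇ n) ≡ true
≤ᵇ-true {m} {n} m≤n with m ≤ᵇ n | ≤ᵇ-reflects-≤ m n
... | true  | _       = refl
... | false | ofⁿ m≰n = contradiction m≤n m≰n

≤ᵇ-false : ∀ {m n} → n < m → (m ≤ᵇ n) ≡ false
≤ᵇ-false {m} {n} n<m with m ≤ᵇ n | ≤ᵇ-reflects-≤ m n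
... | false | _       = refl
... | true  | ofʸ m≤n = contradiction m≤n (<⇒≱ n<m)

≤ᵇ-cong : ∀ {m n m′ n′} → (m ≤ n → m′ ≤ n′) → (m′ ≤ n′ → m ≤ n) →
          (m ≤ᵇ n) ≡ (m′ ≤ᵇ n′)
≤ᵇ-cong {m} {n} {m′} {n′} to from with m ≤ᵇ n | ≤ᵇ-reflects-≤ m n
... | true  | ofʸ m≤n = sym (≤ᵇ-true (to m≤n))
... | false | ofⁿ m≰n = sym (≤ᵇ-false (≰⇒> (m≰n ∘ from)))

∑< : ℕ → (ℕ → ℕ) → ℕ
∑< zero    f = 0
∑< (suc n) f = ∑< n f + f n

-- The summand extends over _*_ and _C_ but not over _+_.
infixr 6.4 ∑<
syntax ∑< n (λ i → e) = ∑[ i < n ] e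

∑-cong : ∀ n {f g : ℕ → ℕ} → (∀ i → i < n → f i ≡ g i) → ∑< n f ≡ ∑< n g
∑-cong zero    f≗g = refl
∑-cong (suc n) f≗g = cong₂ _+_ (∑-cong n (λ i i<n → f≗g i (m<n⇒m<1+n i<n))) (f≗g n (n<1+n n))

∑-zero : ∀ n → ∑[ i < n ] 0 ≡ 0
∑-zero zero    = refl
∑-zero (suc n) = cong (_+ 0) (∑-zero n)

∑-const-1 : ∀ n → ∑[ i < n ] 1 ≡ n
∑-const-1 zero    = refl
∑-const-1 (suc n) = trans (cong (_+ 1) (∑-const-1 n)) (+-comm n 1)

∑-distrib-+ : ∀ n f g → ∑[ i < n ] (f i + g i) ≡ ∑< n f + ∑< n g
∑-distrib-+ zero    f g = refl
∑-distrib-+ (suc n) f g = begin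
  ∑[ i < n ] (f i + g i) + (f n + g n) ≡⟨ cong (_+ (f n + g n)) (∑-distrib-+ n f g) ⟩
  ∑< n f + ∑< n g + (f n + g n)        ≡⟨ +-interchange (∑< n f) (∑< n g) (f n) (g n) ⟩
  ∑< n f + f n + (∑< n g + g n)        ∎
  where open ≡-Reasoning

∑-distribˡ-* : ∀ n c f → c * ∑< n f ≡ ∑[ i < n ] c * f i
∑-distribˡ-* zero    c f = *-zeroʳ c
∑-distribˡ-* (suc n) c f =
  trans (*-distribˡ-+ c (∑< n f) (f n)) (cong (_+ c * f n) (∑-distribˡ-* n c f))

∑-distribʳ-* : ∀ n c f → ∑< n f * c ≡ ∑[ i < n ] f i * c
∑-distribʳ-* zero    c f = refl
∑-distribʳ-* (suc n) c f =
  trans (*-distribʳ-+ c (∑< n f) (f n)) (cong (_+ f n * c) (∑-distribʳ-* n c f))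

∑-comm : ∀ m n (f : ℕ → ℕ → ℕ) → ∑[ i < m ] ∑[ j < n ] f i j ≡ ∑[ j < n ] ∑[ i < m ] f i j
∑-comm zero    n f = sym (∑-zero n)
∑-comm (suc m) n f = begin
  ∑[ i < m ] ∑[ j < n ] f i j + ∑[ j < n ] f m j ≡⟨ cong (_+ ∑[ j < n ] f m j) (∑-comm m n f) ⟩
  ∑[ j < n ] ∑[ i < m ] f i j + ∑[ j < n ] f m j ≡⟨ ∑-distrib-+ n (λ j → ∑[ i < m ] f i j) (f m) ⟨
  ∑[ j < n ] (∑[ i < m ] f i j + f m j)          ∎
  where open ≡-Reasoning

∑-split : ∀ m n f → ∑< (m + n) f ≡ ∑< m f + ∑[ i < n ] f (m + i)
∑-split m zero    f = trans (cong (λ k → ∑< k f) (+-identityʳ m)) (sym (+-identityʳ (∑< m f)))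
∑-split m (suc n) f = begin
  ∑< (m + suc n) f                              ≡⟨ cong (λ k → ∑< k f) (+-suc m n) ⟩
  ∑< (m + n) f + f (m + n)                      ≡⟨ cong (_+ f (m + n)) (∑-split m n f) ⟩
  ∑< m f + ∑[ i < n ] f (m + i) + f (m + n)     ≡⟨ +-assoc (∑< m f) _ _ ⟩
  ∑< m f + (∑[ i < n ] f (m + i) + f (m + n))   ∎
  where open ≡-Reasoning

∑-blocks : ∀ t b f → ∑< (t * b) f ≡ ∑[ q < t ] ∑[ r < b ] f (q * b + r)
∑-blocks zero    b f = refl
∑-blocks (suc t) b f = begin
  ∑< (b + t * b) f
    ≡⟨ cong (λ k → ∑< k f) (+-comm b (t * b)) ⟩
  ∑< (t * b + b) f
    ≡⟨ ∑-split (t * b) b f ⟩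
  ∑< (t * b) f + ∑[ r < b ] f (t * b + r)
    ≡⟨ cong (_+ ∑[ r < b ] f (t * b + r)) (∑-blocks t b f) ⟩
  ∑[ q < t ] ∑[ r < b ] f (q * b + r) + ∑[ r < b ] f (t * b + r) ∎
  where open ≡-Reasoning

∑-restrict : ∀ {y N} f → y ≤ N → ∑[ x < suc N ] f x * 𝟙 (x ≤ᵇ y) ≡ ∑< (suc y) f
∑-restrict {y} {N} f y≤N = begin
  ∑[ x < suc N ] f x * 𝟙 (x ≤ᵇ y)
    ≡⟨ cong (λ k → ∑[ x < suc k ] f x * 𝟙 (x ≤ᵇ y)) (m+[n∸m]≡n y≤N) ⟨
  ∑[ x < suc y + (N ∸ y) ] f x * 𝟙 (x ≤ᵇ y)
    ≡⟨ ∑-split (suc y) (N ∸ y) _ ⟩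
  ∑[ x < suc y ] f x * 𝟙 (x ≤ᵇ y) + ∑[ i < N ∸ y ] f (suc y + i) * 𝟙 (suc y + i ≤ᵇ y)
    ≡⟨ cong₂ _+_ (∑-cong (suc y) below) (trans (∑-cong (N ∸ y) above) (∑-zero (N ∸ y))) ⟩
  ∑< (suc y) f + 0
    ≡⟨ +-identityʳ _ ⟩
  ∑< (suc y) f ∎
  where
  open ≡-Reasoning
  below : ∀ x → x < suc y → f x * 𝟙 (x ≤ᵇ y) ≡ f x
  below x x<1+y = trans (cong (λ b → f x * 𝟙 b) (≤ᵇ-true (≤-pred x<1+y))) (*-identityʳ (f x))
  above : ∀ i → i < N ∸ y → f (suc y + i) * 𝟙 (suc y + i ≤ᵇ y) ≡ 0
  above i _ = trans (cong (λ b → f (suc y + i) * 𝟙 b) (≤ᵇ-false (s≤s (m≤m+n y i))))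
                    (*-zeroʳ (f (suc y + i)))

private variable
  X Y : Set

count : (X → Bool) → List X → ℕ
count p xs = length (filterᵇ p xs)

count-∷ : ∀ (p : X → Bool) x xs → count p (x ∷ xs) ≡ 𝟙 (p x) + count p xs
count-∷ p x xs with p x
... | true  = refl
... | false = refl

count-++ : ∀ (p : X → Bool) xs ys → count p (xs ++ ys) ≡ count p xs + count p ys
count-++ p xs ys = trans (cong length (filter-++ (T? ∘ p) xs ys)) (length-++ (filterᵇ p xs))

count-false : ∀ (xs : List X) → count (λ _ → false) xs ≡ 0
count-false []       = refl
count-false (x ∷ xs) = count-false xs

count-∧ˡ : ∀ b (p : X → Bool) xs → count (λ x → b ∧ p x) xs ≡ 𝟙 b * count p xs
count-∧ˡ true  p xs = sym (+-identityʳ (count p xs))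
count-∧ˡ false p xs = count-false xs

count-map : ∀ (p : Y → Bool) (g : X → Y) xs → count p (map g xs) ≡ count (p ∘ g) xs
count-map p g []       = refl
count-map p g (x ∷ xs) = begin
  count p (g x ∷ map g xs)        ≡⟨ count-∷ p (g x) (map g xs) ⟩
  𝟙 (p (g x)) + count p (map g xs) ≡⟨ cong (𝟙 (p (g x)) +_) (count-map p g xs) ⟩
  𝟙 (p (g x)) + count (p ∘ g) xs   ≡⟨ count-∷ (p ∘ g) x xs ⟨
  count (p ∘ g) (x ∷ xs)          ∎
  where open ≡-Reasoning

count-concatMap-upTo : ∀ (p : Y → Bool) (g : ℕ → List Y) n →
                       count p (concatMap g (upTo n)) ≡ ∑[ i < n ] count p (g i)
count-concatMap-upTo p g zero    = refl
count-concatMap-upTo p g (suc n) = begin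
  count p (concatMap g (upTo (suc n)))
    ≡⟨ cong (count p ∘ concatMap g) (applyUpTo-∷ʳ id n) ⟨
  count p (concatMap g (upTo n ∷ʳ n))
    ≡⟨ cong (count p) (concatMap-++ g (upTo n) [ n ]) ⟩
  count p (concatMap g (upTo n) ++ (g n ++ []))
    ≡⟨ count-++ p (concatMap g (upTo n)) (g n ++ []) ⟩
  count p (concatMap g (upTo n)) + count p (g n ++ [])
    ≡⟨ cong₂ _+_ (count-concatMap-upTo p g n) (cong (count p) (++-identityʳ (g n))) ⟩
  ∑[ i < n ] count p (g i) + count p (g n) ∎
  where open ≡-Reasoning

count-box-[] : ∀ (p : Vec ℕ 0 → Bool) → count p (box []) ≡ 𝟙 (p [])
count-box-[] p with p []
... | true  = refl
... | false = refl

count-box-∷ : ∀ {n} (p : Vec ℕ (suc n) → Bool) b bs →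
              count p (box (b ∷ bs)) ≡ ∑[ x < suc b ] count (λ xs → p (x ∷ xs)) (box bs)
count-box-∷ p b bs = trans (count-concatMap-upTo p (λ x → map (x ∷_) (box bs)) (suc b))
                           (∑-cong (suc b) (λ x _ → count-map p (x ∷_) (box bs)))

C-pascal : ∀ y k → (suc y + suc k) C suc k ≡ (y + suc k) C suc k + (suc y + k) C k
C-pascal y k = begin
  suc (y + suc k) C suc k                   ≡⟨ nCk+nC[k+1]≡[n+1]C[k+1] (y + suc k) k ⟨
  (y + suc k) C k + (y + suc k) C suc k     ≡⟨ +-comm ((y + suc k) C k) _ ⟩
  (y + suc k) C suc k + (y + suc k) C k     ≡⟨ cong (λ n → (y + suc k) C suc k + n C k) (+-suc y k) ⟩
  (y + suc k) C suc k + (suc y + k) C k     ∎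
  where open ≡-Reasoning

∑-C-hockey-stick : ∀ k y → ∑[ x < suc y ] (x + k) C k ≡ (y + suc k) C suc k
∑-C-hockey-stick k zero    = trans (nCn≡1 k) (sym (nCn≡1 (suc k)))
∑-C-hockey-stick k (suc y) = begin
  ∑[ x < suc y ] (x + k) C k + (suc y + k) C k   ≡⟨ cong (_+ (suc y + k) C k) (∑-C-hockey-stick k y) ⟩
  (y + suc k) C suc k + (suc y + k) C k          ≡⟨ C-pascal y k ⟨
  (suc y + suc k) C suc k                        ∎
  where open ≡-Reasoning

C-closed-form : ∀ c k (p q : ℕ → ℕ) → (∀ y → c * ((y + k) C k) ≡ q y) →
                p 0 ≡ c → (∀ y → p y + q (suc y) ≡ p (suc y)) →
                ∀ y → c * ((y + suc k) C suc k) ≡ p y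
C-closed-form c k p q cC≡q p0 p-step zero    =
  trans (cong (c *_) (nCn≡1 (suc k))) (trans (*-identityʳ c) (sym p0))
C-closed-form c k p q cC≡q p0 p-step (suc y) = begin
  c * ((suc y + suc k) C suc k)
    ≡⟨ cong (c *_) (C-pascal y k) ⟩
  c * ((y + suc k) C suc k + (suc y + k) C k)
    ≡⟨ *-distribˡ-+ c _ _ ⟩
  c * ((y + suc k) C suc k) + c * ((suc y + k) C k)
    ≡⟨ cong₂ _+_ (C-closed-form c k p q cC≡q p0 p-step y) (cC≡q (suc y)) ⟩
  p y + q (suc y)
    ≡⟨ p-step y ⟩
  p (suc y) ∎
  where open ≡-Reasoning

24*C₁ : ∀ y → 24 * ((y + 1) C 1) ≡ 24 * (1 + y)
24*C₁ = C-closed-form 24 0 (λ y → 24 * (1 + y)) (λ _ → 24) (λ _ → refl) refl step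
  where step : ∀ y → 24 * (1 + y) + 24 ≡ 24 * (1 + suc y)
        step = solve-∀

24*C₂ : ∀ y → 24 * ((y + 2) C 2) ≡ 12 * ((1 + y) * (2 + y))
24*C₂ = C-closed-form 24 1 _ _ 24*C₁ refl step
  where step : ∀ y → 12 * ((1 + y) * (2 + y)) + 24 * (1 + suc y) ≡ 12 * ((1 + suc y) * (2 + suc y))
        step = solve-∀

24*C₃ : ∀ y → 24 * ((y + 3) C 3) ≡ 4 * ((1 + y) * (2 + y) * (3 + y))
24*C₃ = C-closed-form 24 2 _ _ 24*C₂ refl step
  where step : ∀ y → 4 * ((1 + y) * (2 + y) * (3 + y)) + 12 * ((1 + suc y) * (2 + suc y))
                     ≡ 4 * ((1 + suc y) * (2 + suc y) * (3 + suc y))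
        step = solve-∀

24*C₄ : ∀ y → 24 * ((y + 4) C 4) ≡ (1 + y) * (2 + y) * (3 + y) * (4 + y)
24*C₄ = C-closed-form 24 3 _ _ 24*C₃ refl step
  where step : ∀ y → (1 + y) * (2 + y) * (3 + y) * (4 + y) + 4 * ((1 + suc y) * (2 + suc y) * (3 + suc y))
                     ≡ (1 + suc y) * (2 + suc y) * (3 + suc y) * (4 + suc y)
        step = solve-∀

x*b≤ᵇn≡x≤ᵇn/b : ∀ x n b .{{_ : NonZero b}} → (x * b ≤ᵇ n) ≡ (x ≤ᵇ n / b)
x*b≤ᵇn≡x≤ᵇn/b x n b = ≤ᵇ-cong (λ xb≤n → subst (_≤ n / b) (m*n/n≡m x b) (/-monoˡ-≤ b xb≤n))
                       (λ x≤n/b → ≤-trans (*-monoˡ-≤ b x≤n/b) (m/n*n≤m n b))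

[m*n+o]/n≡m : ∀ m {n o} .{{_ : NonZero n}} → o < n → (m * n + o) / n ≡ m
[m*n+o]/n≡m m {n} {o} o<n = begin
  (m * n + o) / n     ≡⟨ +-distrib-/-∣ˡ o (n∣m*n m) ⟩
  m * n / n + o / n   ≡⟨ cong₂ _+_ (m*n/n≡m m n) (m<n⇒m/n≡0 o<n) ⟩
  m + 0               ≡⟨ +-identityʳ m ⟩
  m                   ∎
  where open ≡-Reasoning

q*[1+a]*a/[1+a]≡q*a : ∀ q a → q * suc a * a / suc a ≡ q * a
q*[1+a]*a/[1+a]≡q*a q a = trans (cong (_/ suc a) (reorder q a)) (m*n/n≡m (q * a) (suc a))
  where reorder : ∀ q a → q * suc a * a ≡ q * a * suc a
        reorder = solve-∀

[q*[1+a]+1+r]*a/[1+a]≡q*a+r : ∀ q {r a} → r < a → (q * suc a + suc r) * a / suc a ≡ q * a + r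
[q*[1+a]+1+r]*a/[1+a]≡q*a+r q {r} {a} r<a with a ∸ suc r | m+[n∸m]≡n r<a
... | d | refl = trans (cong (_/ suc (suc r + d)) (split q r d))
                       ([m*n+o]/n≡m (q * (suc r + d) + r) (s≤s (s≤s (m≤n+m d r))))
  where split : ∀ q r d → (q * suc (suc r + d) + suc r) * (suc r + d)
                          ≡ (q * (suc r + d) + r) * suc (suc r + d) + suc d
        split = solve-∀

∑-floor : ∀ a t h → ∑[ z < suc (t * suc a) ] h (z * a / suc a)
                    ≡ ∑[ q < t ] h (q * a) + ∑[ y < suc (t * a) ] h y
∑-floor a t h = begin
  ∑[ z < t * suc a ] g z + g (t * suc a)
    ≡⟨ cong₂ _+_ (∑-blocks t (suc a) g) (cong h (q*[1+a]*a/[1+a]≡q*a t a)) ⟩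
  ∑[ q < t ] ∑[ r < suc a ] g (q * suc a + r) + h (t * a)
    ≡⟨ cong (_+ h (t * a)) (∑-cong t (λ q _ → block q)) ⟩
  ∑[ q < t ] (h (q * a) + ∑[ r < a ] h (q * a + r)) + h (t * a)
    ≡⟨ cong (_+ h (t * a)) (∑-distrib-+ t _ _) ⟩
  ∑[ q < t ] h (q * a) + ∑[ q < t ] ∑[ r < a ] h (q * a + r) + h (t * a)
    ≡⟨ cong (λ s → ∑[ q < t ] h (q * a) + s + h (t * a)) (∑-blocks t a h) ⟨
  ∑[ q < t ] h (q * a) + ∑< (t * a) h + h (t * a)
    ≡⟨ +-assoc (∑[ q < t ] h (q * a)) _ _ ⟩
  ∑[ q < t ] h (q * a) + ∑[ y < suc (t * a) ] h y ∎
  where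
  open ≡-Reasoning
  g : ℕ → ℕ
  g z = h (z * a / suc a)
  block : ∀ q → ∑[ r < suc a ] g (q * suc a + r) ≡ h (q * a) + ∑[ r < a ] h (q * a + r)
  block q = trans (∑-split 1 a (λ r → g (q * suc a + r)))
                  (cong₂ _+_ (trans (cong g (+-identityʳ (q * suc a))) (cong h (q*[1+a]*a/[1+a]≡q*a q a)))
                             (∑-cong a (λ r r<a → cong h ([q*[1+a]+1+r]*a/[1+a]≡q*a+r q r<a))))

module _ (a t : ℕ) .{{_ : NonZero a}} where

  tails : ℕ → ℕ → ℕ
  tails m x = count (λ xs → inDilate (a ∷ sSeq a m) (x ∷ xs) t) (box (Vec.map (t *_) (sSeq a m)))

  ehrhart≡∑tails : ∀ m → ehrhart (sSeq a (suc m)) t ≡ ∑[ x < suc (t * a) ] tails m x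
  ehrhart≡∑tails m =
    count-box-∷ (λ xs → inDilate (sSeq a (suc m)) xs t) (t * a) (Vec.map (t *_) (sSeq a m))

  tails-suc : ∀ m x → tails (suc m) x ≡ ∑[ x′ < suc (t * a) ] 𝟙 (x ≤ᵇ x′) * tails m x′
  tails-suc m x = trans
    (count-box-∷ (λ xs → inDilate (a ∷ sSeq a (suc m)) (x ∷ xs) t) (t * a) (Vec.map (t *_) (sSeq a m)))
    (∑-cong (suc (t * a)) λ x′ _ → trans
      (count-∧ˡ (x * a ≤ᵇ x′ * a) (λ xs → inDilate (a ∷ sSeq a m) (x′ ∷ xs) t)
                (box (Vec.map (t *_) (sSeq a m))))
      (cong (λ b → 𝟙 b * tails m x′) (≤ᵇ-cong (*-cancelʳ-≤ x x′ a) (*-monoˡ-≤ a))))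

  tails-zero : ∀ x → tails 0 x ≡ ∑[ z < suc (t * suc a) ] 𝟙 (x * suc a ≤ᵇ z * a)
  tails-zero x = trans
    (count-box-∷ (λ xs → inDilate (a ∷ suc a ∷ []) (x ∷ xs) t) (t * suc a) [])
    (∑-cong (suc (t * suc a)) λ z z<1+T → trans
      (count-box-[] (λ xs → inDilate (a ∷ suc a ∷ []) (x ∷ z ∷ xs) t))
      (cong 𝟙 (trans (cong ((x * suc a ≤ᵇ z * a) ∧_) (≤ᵇ-true (≤-pred z<1+T))) (∧-identityʳ _))))

  weightedTails : ℕ → ℕ → ℕ
  weightedTails k m = ∑[ x < suc (t * a) ] ((x + k) C k) * tails m x

  -- Summing out the first coordinate: the weight (x + k) C k counts the chains
  -- x₁ ≤ ⋯ ≤ x_k ≤ x of coordinates already summed out.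
  weightedTails-suc : ∀ k m → weightedTails k (suc m) ≡ weightedTails (suc k) m
  weightedTails-suc k m = begin
    ∑[ x < suc A ] F x * tails (suc m) x
      ≡⟨ ∑-cong (suc A) (λ x _ → trans (cong (F x *_) (tails-suc m x)) (∑-distribˡ-* (suc A) (F x) _)) ⟩
    ∑[ x < suc A ] ∑[ x′ < suc A ] F x * (𝟙 (x ≤ᵇ x′) * tails m x′)
      ≡⟨ ∑-comm (suc A) (suc A) _ ⟩
    ∑[ x′ < suc A ] ∑[ x < suc A ] F x * (𝟙 (x ≤ᵇ x′) * tails m x′)
      ≡⟨ ∑-cong (suc A) (λ x′ _ → trans (∑-cong (suc A) (λ x _ → sym (*-assoc (F x) _ _)))
                                        (sym (∑-distribʳ-* (suc A) (tails m x′) _))) ⟩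
    ∑[ x′ < suc A ] (∑[ x < suc A ] F x * 𝟙 (x ≤ᵇ x′)) * tails m x′
      ≡⟨ ∑-cong (suc A) (λ x′ x′<1+A → cong (_* tails m x′)
           (trans (∑-restrict F (≤-pred x′<1+A)) (∑-C-hockey-stick k x′))) ⟩
    ∑[ x′ < suc A ] ((x′ + suc k) C suc k) * tails m x′ ∎
    where
    open ≡-Reasoning
    A = t * a
    F : ℕ → ℕ
    F x = (x + k) C k

  weightedTails-shift : ∀ k m → weightedTails k m ≡ weightedTails (k + m) 0
  weightedTails-shift k zero    = cong (λ j → weightedTails j 0) (sym (+-identityʳ k))
  weightedTails-shift k (suc m) = begin
    weightedTails k (suc m)        ≡⟨ weightedTails-suc k m ⟩
    weightedTails (suc k) m        ≡⟨ weightedTails-shift (suc k) m ⟩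
    weightedTails (suc k + m) 0    ≡⟨ cong (λ j → weightedTails j 0) (+-suc k m) ⟨
    weightedTails (k + suc m) 0    ∎
    where open ≡-Reasoning

  weightedTails-zero : ∀ k →
    weightedTails k 0 ≡ ∑[ z < suc (t * suc a) ] (z * a / suc a + suc k) C suc k
  weightedTails-zero k = begin
    ∑[ x < suc A ] F x * tails 0 x
      ≡⟨ ∑-cong (suc A) (λ x _ → trans (cong (F x *_) (tails-zero x)) (∑-distribˡ-* (suc T) (F x) _)) ⟩
    ∑[ x < suc A ] ∑[ z < suc T ] F x * 𝟙 (x * suc a ≤ᵇ z * a)
      ≡⟨ ∑-comm (suc A) (suc T) _ ⟩
    ∑[ z < suc T ] ∑[ x < suc A ] F x * 𝟙 (x * suc a ≤ᵇ z * a)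
      ≡⟨ ∑-cong (suc T) (λ z z<1+T → trans
           (∑-cong (suc A) (λ x _ → cong (λ b → F x * 𝟙 b) (x*b≤ᵇn≡x≤ᵇn/b x (z * a) (suc a))))
           (trans (∑-restrict F (floor-bound (≤-pred z<1+T))) (∑-C-hockey-stick k _))) ⟩
    ∑[ z < suc T ] (z * a / suc a + suc k) C suc k ∎
    where
    open ≡-Reasoning
    A = t * a
    T = t * suc a
    F : ℕ → ℕ
    F x = (x + k) C k
    floor-bound : ∀ {z} → z ≤ T → z * a / suc a ≤ A
    floor-bound z≤T =
      ≤-trans (/-monoˡ-≤ (suc a) (*-monoˡ-≤ a z≤T)) (≤-reflexive (q*[1+a]*a/[1+a]≡q*a t a))

  ehrhart-sSeq-suc : ∀ m → ehrhart (sSeq a (suc m)) t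
                         ≡ ∑[ q < t ] (q * a + suc m) C suc m + (t * a + suc (suc m)) C suc (suc m)
  ehrhart-sSeq-suc m = begin
    ehrhart (sSeq a (suc m)) t
      ≡⟨ ehrhart≡∑tails m ⟩
    ∑[ x < suc (t * a) ] tails m x
      ≡⟨ ∑-cong (suc (t * a)) (λ x _ → sym (+-identityʳ (tails m x))) ⟩
    weightedTails 0 m
      ≡⟨ weightedTails-shift 0 m ⟩
    weightedTails m 0
      ≡⟨ weightedTails-zero m ⟩
    ∑[ z < suc (t * suc a) ] (z * a / suc a + suc m) C suc m
      ≡⟨ ∑-floor a t (λ y → (y + suc m) C suc m) ⟩
    ∑[ q < t ] (q * a + suc m) C suc m + ∑[ y < suc (t * a) ] (y + suc m) C suc m
      ≡⟨ cong (∑[ q < t ] (q * a + suc m) C suc m +_) (∑-C-hockey-stick (suc m) (t * a)) ⟩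
    ∑[ q < t ] (q * a + suc m) C suc m + (t * a + suc (suc m)) C suc (suc m) ∎
    where open ≡-Reasoning

ehrhart-sSeq-zero : ∀ a t → ehrhart (sSeq a 0) t ≡ suc (t * suc a)
ehrhart-sSeq-zero a t = begin
  ehrhart (sSeq a 0) t
    ≡⟨ count-box-∷ (λ xs → inDilate (suc a ∷ []) xs t) (t * suc a) [] ⟩
  ∑[ z < suc (t * suc a) ] count (λ xs → inDilate (suc a ∷ []) (z ∷ xs) t) (box [])
    ≡⟨ ∑-cong (suc (t * suc a)) (λ z z<1+T →
         trans (count-box-[] (λ xs → inDilate (suc a ∷ []) (z ∷ xs) t)) (cong 𝟙 (≤ᵇ-true (≤-pred z<1+T)))) ⟩
  ∑[ z < suc (t * suc a) ] 1
    ≡⟨ ∑-const-1 (suc (t * suc a)) ⟩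
  suc (t * suc a) ∎
  where open ≡-Reasoning

evalPolyℕ : List ℕ → ℕ → ℕ
evalPolyℕ []       x = 0
evalPolyℕ (c ∷ cs) x = c + x * evalPolyℕ cs x

ℕtoℚ≡mkℚ : ∀ n → ℕtoℚ n ≡ mkℚ (ℤ.+ n) 0 (Coprime.sym (1-coprimeTo n))
ℕtoℚ≡mkℚ n = normalize-coprime (Coprime.sym (1-coprimeTo n))

ℕtoℚ-+ : ∀ m n → ℕtoℚ (m + n) ≡ ℕtoℚ m ℚ.+ ℕtoℚ n
ℕtoℚ-+ m n rewrite ℕtoℚ≡mkℚ m | ℕtoℚ≡mkℚ n =
  cong (ℚ._/ 1) (cong₂ ℤ._+_ (sym (ℤ.*-identityʳ (ℤ.+ m))) (sym (ℤ.*-identityʳ (ℤ.+ n))))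

ℕtoℚ-* : ∀ m n → ℕtoℚ (m * n) ≡ ℕtoℚ m ℚ.* ℕtoℚ n
ℕtoℚ-* m n rewrite ℕtoℚ≡mkℚ m | ℕtoℚ≡mkℚ n = cong (ℚ._/ 1) (ℤ.pos-* m n)

evalPoly-ℕtoℚ : ∀ cs t → evalPoly (map ℕtoℚ cs) (ℕtoℚ t) ≡ ℕtoℚ (evalPolyℕ cs t)
evalPoly-ℕtoℚ []       t = refl
evalPoly-ℕtoℚ (c ∷ cs) t rewrite evalPoly-ℕtoℚ cs t =
  sym (trans (ℕtoℚ-+ c (t * evalPolyℕ cs t)) (cong (ℕtoℚ c ℚ.+_) (ℕtoℚ-* t (evalPolyℕ cs t))))

evalPoly-map-*ʳ : ∀ r cs x → evalPoly (map (ℚ._* r) cs) x ≡ evalPoly cs x ℚ.* r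
evalPoly-map-*ʳ r []       x = sym (ℚ-*-zeroˡ r)
evalPoly-map-*ʳ r (c ∷ cs) x rewrite evalPoly-map-*ʳ r cs x =
  sym (trans (ℚ-*-distribʳ-+ r c (x ℚ.* evalPoly cs x)) (cong (c ℚ.* r ℚ.+_) (ℚ-*-assoc x _ r)))

_/24 : ℕ → ℚ
c /24 = ℤ.+ c ℚ./ 24

/24≡*1/24 : ∀ c → c /24 ≡ ℕtoℚ c ℚ.* (ℤ.+ 1 ℚ./ 24)
/24≡*1/24 c rewrite ℕtoℚ≡mkℚ c = cong (ℚ._/ 24) (sym (ℤ.*-identityʳ (ℤ.+ c)))

evalPoly-/24 : ∀ cs t L → 24 * L ≡ evalPolyℕ cs t → evalPoly (map _/24 cs) (ℕtoℚ t) ≡ ℕtoℚ L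
evalPoly-/24 cs t L 24L≡ = begin
  evalPoly (map _/24 cs) (ℕtoℚ t)
    ≡⟨ cong (λ ds → evalPoly ds (ℕtoℚ t)) (trans (map-cong /24≡*1/24 cs) (map-∘ cs)) ⟩
  evalPoly (map (ℚ._* r) (map ℕtoℚ cs)) (ℕtoℚ t)
    ≡⟨ evalPoly-map-*ʳ r (map ℕtoℚ cs) (ℕtoℚ t) ⟩
  evalPoly (map ℕtoℚ cs) (ℕtoℚ t) ℚ.* r
    ≡⟨ cong (ℚ._* r) (evalPoly-ℕtoℚ cs t) ⟩
  ℕtoℚ (evalPolyℕ cs t) ℚ.* r
    ≡⟨ cong (λ n → ℕtoℚ n ℚ.* r) 24L≡ ⟨
  ℕtoℚ (24 * L) ℚ.* r
    ≡⟨ cong (ℚ._* r) (trans (ℕtoℚ-* 24 L) (ℚ-*-comm (ℕtoℚ 24) (ℕtoℚ L))) ⟩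
  ℕtoℚ L ℚ.* ℕtoℚ 24 ℚ.* r
    ≡⟨ ℚ-*-assoc (ℕtoℚ L) (ℕtoℚ 24) r ⟩
  ℕtoℚ L ℚ.* 1ℚ
    ≡⟨ ℚ-*-identityʳ (ℕtoℚ L) ⟩
  ℕtoℚ L ∎
  where
  open ≡-Reasoning
  r = ℤ.+ 1 ℚ./ 24

All-/24-nonNegative : ∀ cs → All (0ℚ ℚ.≤_) (map _/24 cs)
All-/24-nonNegative []       = []
All-/24-nonNegative (c ∷ cs) = nonNegative⁻¹ (c /24) {{normalize-nonNeg c 24}} ∷ All-/24-nonNegative cs

24*ehrhart-polynomial⇒EhrhartPositive : ∀ {n} (s : Vec ℕ n) cs →
  (∀ t → 1 ≤ t → 24 * ehrhart s t ≡ evalPolyℕ cs t) → EhrhartPositive s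
24*ehrhart-polynomial⇒EhrhartPositive s cs 24L≡ =
  map _/24 cs , All-/24-nonNegative cs , λ t t≥1 → evalPoly-/24 cs t (ehrhart s t) (24L≡ t t≥1)

closed-form-in-t : ∀ c a (h H : ℕ → ℕ) {p Q : ℕ → ℕ} (P : ℕ → ℕ) →
                   (∀ y → c * h y ≡ p y) → (∀ y → c * H y ≡ Q y) → Q 0 ≡ P 0 →
                   (∀ t → P t + p (t * a) + Q (a + t * a) ≡ P (suc t) + Q (t * a)) →
                   ∀ t → c * (∑[ q < t ] h (q * a) + H (t * a)) ≡ P t
closed-form-in-t c a h H {p} {Q} P ch≡p cH≡Q base step zero    = trans (cH≡Q 0) base
closed-form-in-t c a h H {p} {Q} P ch≡p cH≡Q base step (suc t) = +-cancelʳ-≡ (Q (t * a)) _ _ (begin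
  c * (S + h (t * a) + H (a + t * a)) + Q (t * a)
    ≡⟨ cong (c * (S + h (t * a) + H (a + t * a)) +_) (cH≡Q (t * a)) ⟨
  c * (S + h (t * a) + H (a + t * a)) + c * H (t * a)
    ≡⟨ regroup c S (h (t * a)) (H (a + t * a)) (H (t * a)) ⟩
  c * (S + H (t * a)) + c * h (t * a) + c * H (a + t * a)
    ≡⟨ cong₂ _+_ (cong₂ _+_ (closed-form-in-t c a h H P ch≡p cH≡Q base step t) (ch≡p (t * a)))
                 (cH≡Q (a + t * a)) ⟩
  P t + p (t * a) + Q (a + t * a)
    ≡⟨ step t ⟩
  P (suc t) + Q (t * a) ∎)
  where
  open ≡-Reasoning
  S = ∑[ q < t ] h (q * a)
  regroup : ∀ c S x y z → c * (S + x + y) + c * z ≡ c * (S + z) + c * x + c * y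
  regroup = solve-∀

coeffs₀ coeffs₁ coeffs₂ coeffs₃ : ℕ → List ℕ
coeffs₀ a = 24 ∷ 24 + 24 * a ∷ []
coeffs₁ a = 24 ∷ 24 + 24 * a ∷ 12 * a + 12 * (a * a) ∷ []
coeffs₂ a = 24 ∷ 24 + 26 * a + 2 * (a * a) ∷ 18 * a + 18 * (a * a)
          ∷ 4 * (a * a) + 4 * (a * a * a) ∷ []
coeffs₃ a = 24 ∷ 24 + 28 * a + 4 * (a * a) ∷ 22 * a + 23 * (a * a) + a * a * a
          ∷ 8 * (a * a) + 8 * (a * a * a) ∷ a * a * a + a * a * a * a ∷ []

-- The ring solver does not unfold evalPolyℕ, so below it is written out in Horner form.

24*ehrhart-sSeq₀ : ∀ a t → 24 * ehrhart (sSeq a 0) t ≡ evalPolyℕ (coeffs₀ a) t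
24*ehrhart-sSeq₀ a t = trans (cong (24 *_) (ehrhart-sSeq-zero a t)) (poly a t)
  where poly : ∀ a t → 24 * (1 + t * (1 + a)) ≡ 24 + t * ((24 + 24 * a) + t * 0)
        poly = solve-∀

24*ehrhart-sSeq₁ : ∀ a t .{{_ : NonZero a}} → 24 * ehrhart (sSeq a 1) t ≡ evalPolyℕ (coeffs₁ a) t
24*ehrhart-sSeq₁ a t = trans (cong (24 *_) (ehrhart-sSeq-suc a t 0))
  (closed-form-in-t 24 a (λ y → (y + 1) C 1) (λ y → (y + 2) C 2) (evalPolyℕ (coeffs₁ a))
                    24*C₁ 24*C₂ refl (step a) t)
  where
  step : ∀ a t →
      (24 + t * (24 + 24 * a
        + t * (12 * a + 12 * (a * a) + t * 0)))
      + 24 * (1 + t * a)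
      + 12 * ((1 + (a + t * a)) * (2 + (a + t * a)))
    ≡ (24 + (1 + t) * (24 + 24 * a
        + (1 + t) * (12 * a + 12 * (a * a) + (1 + t) * 0)))
      + 12 * ((1 + t * a) * (2 + t * a))
  step = solve-∀

24*ehrhart-sSeq₂ : ∀ a t .{{_ : NonZero a}} → 24 * ehrhart (sSeq a 2) t ≡ evalPolyℕ (coeffs₂ a) t
24*ehrhart-sSeq₂ a t = trans (cong (24 *_) (ehrhart-sSeq-suc a t 1))
  (closed-form-in-t 24 a (λ y → (y + 2) C 2) (λ y → (y + 3) C 3) (evalPolyℕ (coeffs₂ a))
                    24*C₂ 24*C₃ refl (step a) t)
  where
  step : ∀ a t →
      (24 + t * (24 + 26 * a + 2 * (a * a)
        + t * (18 * a + 18 * (a * a)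
        + t * (4 * (a * a) + 4 * (a * a * a) + t * 0))))
      + 12 * ((1 + t * a) * (2 + t * a))
      + 4 * ((1 + (a + t * a)) * (2 + (a + t * a)) * (3 + (a + t * a)))
    ≡ (24 + (1 + t) * (24 + 26 * a + 2 * (a * a)
        + (1 + t) * (18 * a + 18 * (a * a)
        + (1 + t) * (4 * (a * a) + 4 * (a * a * a) + (1 + t) * 0))))
      + 4 * ((1 + t * a) * (2 + t * a) * (3 + t * a))
  step = solve-∀

24*ehrhart-sSeq₃ : ∀ a t .{{_ : NonZero a}} → 24 * ehrhart (sSeq a 3) t ≡ evalPolyℕ (coeffs₃ a) t
24*ehrhart-sSeq₃ a t = trans (cong (24 *_) (ehrhart-sSeq-suc a t 2))
  (closed-form-in-t 24 a (λ y → (y + 3) C 3) (λ y → (y + 4) C 4) (evalPolyℕ (coeffs₃ a))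
                    24*C₃ 24*C₄ refl (step a) t)
  where
  step : ∀ a t →
      (24 + t * (24 + 28 * a + 4 * (a * a)
        + t * (22 * a + 23 * (a * a) + a * a * a
        + t * (8 * (a * a) + 8 * (a * a * a)
        + t * (a * a * a + a * a * a * a + t * 0)))))
      + 4 * ((1 + t * a) * (2 + t * a) * (3 + t * a))
      + (1 + (a + t * a)) * (2 + (a + t * a)) * (3 + (a + t * a)) * (4 + (a + t * a))
    ≡ (24 + (1 + t) * (24 + 28 * a + 4 * (a * a)
        + (1 + t) * (22 * a + 23 * (a * a) + a * a * a
        + (1 + t) * (8 * (a * a) + 8 * (a * a * a)
        + (1 + t) * (a * a * a + a * a * a * a + (1 + t) * 0)))))
      + (1 + t * a) * (2 + t * a) * (3 + t * a) * (4 + t * a)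
  step = solve-∀

theorem3p2 : (a m : ℕ) → 1 ≤ a → m ≤ 3 → EhrhartPositive (sSeq a m)
theorem3p2 a 0 _ _ =
  24*ehrhart-polynomial⇒EhrhartPositive (sSeq a 0) (coeffs₀ a) (λ t _ → 24*ehrhart-sSeq₀ a t)
theorem3p2 a 1 a≥1 _ =
  24*ehrhart-polynomial⇒EhrhartPositive (sSeq a 1) (coeffs₁ a) (λ t _ → 24*ehrhart-sSeq₁ a t)
  where instance _ = >-nonZero a≥1
theorem3p2 a 2 a≥1 _ =
  24*ehrhart-polynomial⇒EhrhartPositive (sSeq a 2) (coeffs₂ a) (λ t _ → 24*ehrhart-sSeq₂ a t)
  where instance _ = >-nonZero a≥1
theorem3p2 a 3 a≥1 _ =
  24*ehrhart-polynomial⇒EhrhartPositive (sSeq a 3) (coeffs₃ a) (λ t _ → 24*ehrhart-sSeq₃ a t)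
  where instance _ = >-nonZero a≥1
theorem3p2 a (suc (suc (suc (suc _)))) _ (s≤s (s≤s (s≤s ())))
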